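{- Let $\varphi^{(0)}$ and $\psi$ be formal power series in $q$ with integer coefficients, $$\varphi^{(0)}=a_k^{(0)}q^k+\sum_{j\ge k+1}a_j^{(0)}q^j\ \ (a_k^{(0)}\ge1,\ a_j^{(0)}\in\mathbb{Z}),\qquad \psi=b_0+b_1q+\sum_{j\ge2}b_jq^j\ \ (b_0,b_1\ge1,\ b_j\ge0),$$ and set $\varphi^{(n)}:=\varphi^{(0)}\psi^n=\sum_{j\ge k}a_j^{(n)}q^j$ for $n\ge0$. Then the sequence $M_n:=\max\{m\in\mathbb{N}: a_j^{(n)}>0 \text{ for all } k\le j\le m\}$, $n\ge 0$, is nondecreasing and unbounded.
   Context: $\mathbb{N}=\{0,1,2,\dots\}$. -}

module Defs where

open import Data.Nat using (ℕ; zero; suc; _∸_)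
open import Data.Integer using (ℤ; _+_; _*_; 0ℤ; 1ℤ)

Series : Set
Series = ℕ → ℤ

sumTo : ℕ → (ℕ → ℤ) → ℤ
sumTo zero    g = g zero
sumTo (suc n) g = sumTo n g + g (suc n)

_·ₛ_ : Series → Series → Series
(f ·ₛ g) n = sumTo n (λ i → f i * g (n ∸ i))

oneₛ : Series
oneₛ zero    = 1ℤ
oneₛ (suc _) = 0ℤ

_^ₛ_ : Series → ℕ → Series
ψ ^ₛ zero  = oneₛ
ψ ^ₛ suc n = ψ ·ₛ (ψ ^ₛ n)

φSeq : Series → Series → ℕ → Series
φSeq φ₀ ψ n = φ₀ ·ₛ (ψ ^ₛ n)

open import Data.Nat using (_≤_)
open import Data.Integer using (_>_)

-- m belongs to the set {m ∈ ℕ : a_j > 0 for all k ≤ j ≤ m} whose maximum is M_n.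
InMSet : ℕ → Series → ℕ → Set
InMSet k a m = ∀ j → k ≤ j → j ≤ m → a j > 0ℤ

{-# OPTIONS --safe #-}
module Submission where

-- Since φ⁽ⁿ⁺¹⁾ = ψ φ⁽ⁿ⁾ and ψ has nonnegative coefficients with ψ₀ > 0, we get
-- a⁽ⁿ⁺¹⁾ⱼ ≥ ψ₀ a⁽ⁿ⁾ⱼ whenever a⁽ⁿ⁾ is nonnegative up to j (the coefficients below
-- k vanish), so positivity on [k, m] persists.  For unboundedness, let a⁽ⁿ⁾ be
-- positive on [k, M] and put xₙ = a⁽ⁿ⁾_{M+1}, dₙ = a⁽ⁿ⁾_M ≥ 1.  Then
-- xₙ₊₁ ≥ ψ₀ xₙ + ψ₁ dₙ ≥ ψ₀ xₙ + dₙ and dₙ₊₁ ≥ ψ₀ dₙ, so positivity of the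
-- potential ψ₀ xₙ + (C + 1) dₙ implies positivity of ψ₀ xₙ₊₁ + C dₙ₊₁.
-- Starting from C = 1 + |ψ₀ xₙ| and counting C down to 0 gives a stage at
-- which x is positive as well.

open import Defs
open import Data.Nat using (ℕ; suc; _≤_; _<_)
open import Data.Integer using (ℤ; _≥_; 0ℤ; 1ℤ)
open import Data.Product using (_×_; ∃)
open import Relation.Binary.PropositionalEquality using (_≡_)

open import Data.Nat using (zero; _∸_; z≤n; s≤s)
import Data.Nat.Properties as ℕ
open import Data.Integer
  using (+_; -[1+_]; +[1+_]; -_; _+_; _*_; ∣_∣; +≤+; +<+; nonNegative)
  renaming (_≤_ to _≤ℤ_; _<_ to _<ℤ_)
import Data.Integer.Properties as ℤ
open import Data.Integer.Solver using (module +-*-Solver)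
open import Algebra.Properties.CommutativeSemigroup ℤ.+-commutativeSemigroup
  using () renaming (interchange to +-interchange)
open import Algebra.Properties.CommutativeSemigroup ℤ.*-commutativeSemigroup
  using () renaming (x∙yz≈y∙xz to *-leftComm)
open import Data.Product using (_,_; proj₂)
open import Data.Sum using (inj₁; inj₂)
open import Relation.Nullary using (yes; no)
open import Function using (flip; _∘_)
open import Relation.Binary.PropositionalEquality
  using (refl; sym; trans; cong; cong₂; subst; _≗_; module ≡-Reasoning)

open +-*-Solver

∀≤suc⇒∀≤ : ∀ {n} {P : ℕ → Set} → (∀ i → i ≤ suc n → P i) → ∀ i → i ≤ n → P i
∀≤suc⇒∀≤ p i i≤n = p i (ℕ.m≤n⇒m≤1+n i≤n)

sumTo-cong : ∀ n {g h : ℕ → ℤ} → (∀ i → i ≤ n → g i ≡ h i) → sumTo n g ≡ sumTo n h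
sumTo-cong zero    g≡h = g≡h 0 z≤n
sumTo-cong (suc n) g≡h =
  cong₂ _+_ (sumTo-cong n (∀≤suc⇒∀≤ g≡h)) (g≡h (suc n) ℕ.≤-refl)

sumTo-zero : ∀ n {g : ℕ → ℤ} → (∀ i → i ≤ n → g i ≡ 0ℤ) → sumTo n g ≡ 0ℤ
sumTo-zero zero    g≡0 = g≡0 0 z≤n
sumTo-zero (suc n) g≡0 =
  cong₂ _+_ (sumTo-zero n (∀≤suc⇒∀≤ g≡0)) (g≡0 (suc n) ℕ.≤-refl)

sumTo-+ : ∀ n (g h : ℕ → ℤ) → sumTo n (λ i → g i + h i) ≡ sumTo n g + sumTo n h
sumTo-+ zero    g h = refl
sumTo-+ (suc n) g h = trans (cong (_+ (g (suc n) + h (suc n))) (sumTo-+ n g h))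
  (+-interchange (sumTo n g) (sumTo n h) (g (suc n)) (h (suc n)))

*-distribˡ-sumTo : ∀ n c (g : ℕ → ℤ) → c * sumTo n g ≡ sumTo n (λ i → c * g i)
*-distribˡ-sumTo zero    c g = refl
*-distribˡ-sumTo (suc n) c g = trans (ℤ.*-distribˡ-+ c (sumTo n g) (g (suc n)))
  (cong (_+ c * g (suc n)) (*-distribˡ-sumTo n c g))

sumTo-uncons : ∀ n (g : ℕ → ℤ) → sumTo (suc n) g ≡ g 0 + sumTo n (λ i → g (suc i))
sumTo-uncons zero    g = refl
sumTo-uncons (suc n) g = trans (cong (_+ g (suc (suc n))) (sumTo-uncons n g))
  (ℤ.+-assoc (g 0) (sumTo n (λ i → g (suc i))) (g (suc (suc n))))

sumTo-reverse : ∀ n (g : ℕ → ℤ) → sumTo n g ≡ sumTo n (λ i → g (n ∸ i))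
sumTo-reverse zero    g = refl
sumTo-reverse (suc n) g = begin
  sumTo n g + g (suc n)                       ≡⟨ ℤ.+-comm (sumTo n g) (g (suc n)) ⟩
  g (suc n) + sumTo n g                       ≡⟨ cong (_+_ (g (suc n))) (sumTo-reverse n g) ⟩
  g (suc n) + sumTo n (λ i → g (n ∸ i))       ≡⟨ sumTo-uncons n (λ i → g (suc n ∸ i)) ⟨
  sumTo (suc n) (λ i → g (suc n ∸ i))         ∎
  where open ≡-Reasoning

triangle : ℕ → (ℕ → ℕ → ℤ) → ℤ
triangle n f = sumTo n (λ i → sumTo (n ∸ i) (f i))

diagonal : ℕ → (ℕ → ℕ → ℤ) → ℤ
diagonal n f = sumTo n (λ i → f i (n ∸ i))

triangle-suc : ∀ n f → triangle (suc n) f ≡ triangle n f + diagonal (suc n) f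
triangle-suc n f = begin
  triangle (suc n) f
    ≡⟨ cong₂ _+_ (sumTo-cong n row) corner ⟩
  sumTo n (λ i → sumTo (n ∸ i) (f i) + f i (suc n ∸ i)) + f (suc n) (n ∸ n)
    ≡⟨ cong (_+ f (suc n) (n ∸ n)) (sumTo-+ n (λ i → sumTo (n ∸ i) (f i)) (λ i → f i (suc n ∸ i))) ⟩
  (triangle n f + sumTo n (λ i → f i (suc n ∸ i))) + f (suc n) (n ∸ n)
    ≡⟨ ℤ.+-assoc (triangle n f) _ _ ⟩
  triangle n f + diagonal (suc n) f
    ∎
  where
  open ≡-Reasoning
  row : ∀ i → i ≤ n → sumTo (suc n ∸ i) (f i) ≡ sumTo (n ∸ i) (f i) + f i (suc n ∸ i)
  row i i≤n rewrite ℕ.+-∸-assoc 1 i≤n = refl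
  corner : sumTo (n ∸ n) (f (suc n)) ≡ f (suc n) (n ∸ n)
  corner rewrite ℕ.n∸n≡0 n = refl

diagonal-flip : ∀ n f → diagonal n (flip f) ≡ diagonal n f
diagonal-flip n f = sym (trans (sumTo-reverse n (λ i → f i (n ∸ i)))
  (sumTo-cong n (λ i i≤n → cong (f (n ∸ i)) (ℕ.m∸[m∸n]≡n i≤n))))

triangle-flip : ∀ n f → triangle n f ≡ triangle n (flip f)
triangle-flip zero    f = refl
triangle-flip (suc n) f = begin
  triangle (suc n) f
    ≡⟨ triangle-suc n f ⟩
  triangle n f + diagonal (suc n) f
    ≡⟨ cong₂ _+_ (triangle-flip n f) (sym (diagonal-flip (suc n) f)) ⟩
  triangle n (flip f) + diagonal (suc n) (flip f)
    ≡⟨ triangle-suc n (flip f) ⟨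
  triangle (suc n) (flip f)
    ∎
  where open ≡-Reasoning

·ₛ-identityʳ : ∀ f → f ·ₛ oneₛ ≗ f
·ₛ-identityʳ f zero    = ℤ.*-identityʳ (f 0)
·ₛ-identityʳ f (suc j) = trans (cong₂ _+_ (sumTo-zero j off-diagonal) corner) (ℤ.+-identityˡ (f (suc j)))
  where
  off-diagonal : ∀ i → i ≤ j → f i * oneₛ (suc j ∸ i) ≡ 0ℤ
  off-diagonal i i≤j rewrite ℕ.+-∸-assoc 1 i≤j = ℤ.*-zeroʳ (f i)
  corner : f (suc j) * oneₛ (j ∸ j) ≡ f (suc j)
  corner rewrite ℕ.n∸n≡0 j = ℤ.*-identityʳ (f (suc j))

f·gh≗g·fh : ∀ f g h → f ·ₛ (g ·ₛ h) ≗ g ·ₛ (f ·ₛ h)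
f·gh≗g·fh f g h j = begin
  (f ·ₛ (g ·ₛ h)) j
    ≡⟨ sumTo-cong j (λ i _ → *-distribˡ-sumTo (j ∸ i) (f i) _) ⟩
  triangle j (λ i l → f i * (g l * h (j ∸ i ∸ l)))
    ≡⟨ triangle-flip j _ ⟩
  triangle j (λ l i → f i * (g l * h (j ∸ i ∸ l)))
    ≡⟨ sumTo-cong j (λ l _ → sumTo-cong (j ∸ l) (λ i _ → swap l i)) ⟩
  triangle j (λ l i → g l * (f i * h (j ∸ l ∸ i)))
    ≡⟨ sumTo-cong j (λ l _ → *-distribˡ-sumTo (j ∸ l) (g l) _) ⟨
  (g ·ₛ (f ·ₛ h)) j
    ∎
  where
  open ≡-Reasoning
  swap : ∀ l i → f i * (g l * h (j ∸ i ∸ l)) ≡ g l * (f i * h (j ∸ l ∸ i))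
  swap l i rewrite ℕ.∸-+-assoc j i l | ℕ.∸-+-assoc j l i | ℕ.+-comm i l =
    *-leftComm (f i) (g l) _

*-nonNeg : ∀ {i j} → 0ℤ ≤ℤ i → 0ℤ ≤ℤ j → 0ℤ ≤ℤ i * j
*-nonNeg {+ m} {+ n} (+≤+ _) (+≤+ _) = subst (0ℤ ≤ℤ_) (ℤ.pos-* m n) (+≤+ z≤n)

*-pos : ∀ {i j} → 0ℤ <ℤ i → 0ℤ <ℤ j → 0ℤ <ℤ i * j
*-pos {+[1+ m ]} {+[1+ n ]} (+<+ _) (+<+ _) = +<+ (s≤s z≤n)

0<i+[1+∣i∣] : ∀ i → 0ℤ <ℤ i + + suc ∣ i ∣
0<i+[1+∣i∣] (+ n)    = +<+ (ℕ.≤-trans (s≤s z≤n) (ℕ.m≤n+m (suc n) n))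
0<i+[1+∣i∣] -[1+ n ] = subst (0ℤ <ℤ_) (sym (-i+[1+i]≡1 (+ suc n))) (+<+ (s≤s z≤n))
  where
  -i+[1+i]≡1 : ∀ i → - i + (1ℤ + i) ≡ 1ℤ
  -i+[1+i]≡1 = solve 1 (λ i → :- i :+ (con 1ℤ :+ i) := con 1ℤ) refl

sumTo-nonNeg : ∀ n {g : ℕ → ℤ} → (∀ i → i ≤ n → 0ℤ ≤ℤ g i) → 0ℤ ≤ℤ sumTo n g
sumTo-nonNeg zero    g≥0 = g≥0 0 z≤n
sumTo-nonNeg (suc n) g≥0 =
  ℤ.+-mono-≤ (sumTo-nonNeg n (∀≤suc⇒∀≤ g≥0)) (g≥0 (suc n) ℕ.≤-refl)

term≤sumTo : ∀ n {g : ℕ → ℤ} → (∀ i → i ≤ n → 0ℤ ≤ℤ g i) → ∀ {i} → i ≤ n → g i ≤ℤ sumTo n g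
term≤sumTo zero    g≥0 z≤n = ℤ.≤-refl
term≤sumTo (suc n) {g} g≥0 i≤1+n with ℕ.m≤n⇒m<n∨m≡n i≤1+n
... | inj₁ (s≤s i≤n) =
  ℤ.≤-trans (term≤sumTo n (∀≤suc⇒∀≤ g≥0) i≤n) (ℤ.i≤i+j _ _ {{nonNegative (g≥0 (suc n) ℕ.≤-refl)}})
... | inj₂ refl = ℤ.i≤j+i _ _ {{nonNegative (sumTo-nonNeg n (∀≤suc⇒∀≤ g≥0))}}

VanishesBelow : ℕ → Series → Set
VanishesBelow k a = ∀ j → j < k → a j ≡ 0ℤ

·ₛ-vanishesBelowˡ : ∀ {k f} g → VanishesBelow k f → VanishesBelow k (f ·ₛ g)
·ₛ-vanishesBelowˡ g f≡0 l l<k =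
  sumTo-zero l (λ i i≤l → cong (_* g (l ∸ i)) (f≡0 i (ℕ.≤-<-trans i≤l l<k)))

InMSet-nonNeg : ∀ {k a m} → VanishesBelow k a → InMSet k a m → ∀ l → l ≤ m → 0ℤ ≤ℤ a l
InMSet-nonNeg {k} a≡0 a>0 l l≤m with l ℕ.<? k
... | yes l<k = ℤ.≤-reflexive (sym (a≡0 l l<k))
... | no  l≮k = ℤ.<⇒≤ (a>0 l (ℕ.≮⇒≥ l≮k) l≤m)

InMSet-≤k : ∀ {k a m} → 0ℤ <ℤ a k → m ≤ k → InMSet k a m
InMSet-≤k ak>0 m≤k j k≤j j≤m with ℕ.≤-antisym (ℕ.≤-trans j≤m m≤k) k≤j
... | refl = ak>0

InMSet-suc : ∀ {k a m} → InMSet k a m → 0ℤ <ℤ a (suc m) → InMSet k a (suc m)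
InMSet-suc a>0 a[1+m]>0 j k≤j j≤1+m with ℕ.m≤n⇒m<n∨m≡n j≤1+m
... | inj₁ (s≤s j≤m) = a>0 j k≤j j≤m
... | inj₂ refl      = a[1+m]>0

term≤·ₛ : ∀ {ψ a j} → (∀ i → 0ℤ ≤ℤ ψ i) → (∀ l → l ≤ j → 0ℤ ≤ℤ a l) →
          ∀ {i} → i ≤ j → ψ i * a (j ∸ i) ≤ℤ (ψ ·ₛ a) j
term≤·ₛ {j = j} ψ≥0 a≥0 =
  term≤sumTo j (λ i _ → *-nonNeg (ψ≥0 i) (a≥0 (j ∸ i) (ℕ.m∸n≤m j i)))

head≤·ₛ : ∀ {ψ a m} → (∀ i → 0ℤ ≤ℤ ψ i) → (∀ l → l ≤ m → 0ℤ ≤ℤ a l) →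
          ψ 0 * a (suc m) + ψ 1 * a m ≤ℤ (ψ ·ₛ a) (suc m)
head≤·ₛ {ψ} {a} {m} ψ≥0 a≥0 = begin
  ψ 0 * a (suc m) + ψ 1 * a m
    ≤⟨ ℤ.+-monoʳ-≤ (ψ 0 * a (suc m)) (term≤·ₛ {ψ ∘ suc} (ψ≥0 ∘ suc) a≥0 z≤n) ⟩
  ψ 0 * a (suc m) + ((ψ ∘ suc) ·ₛ a) m
    ≡⟨ sumTo-uncons m _ ⟨
  (ψ ·ₛ a) (suc m)
    ∎
  where open ℤ.≤-Reasoning

InMSet-·ₛ : ∀ {ψ a k m} → (∀ i → 0ℤ ≤ℤ ψ i) → 0ℤ <ℤ ψ 0 →
            VanishesBelow k a → InMSet k a m → InMSet k (ψ ·ₛ a) m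
InMSet-·ₛ ψ≥0 ψ₀>0 a≡0 a>0 j k≤j j≤m = ℤ.<-≤-trans
  (*-pos ψ₀>0 (a>0 j k≤j j≤m))
  (term≤·ₛ ψ≥0 (λ l l≤j → InMSet-nonNeg a≡0 a>0 l (ℕ.≤-trans l≤j j≤m)) z≤n)

potential-start : ∀ y {d} → 1ℤ ≤ℤ d → 0ℤ <ℤ y + + suc ∣ y ∣ * d
potential-start y {d} d≥1 = begin-strict
  0ℤ                  <⟨ 0<i+[1+∣i∣] y ⟩
  y + C               ≡⟨ cong (_+_ y) (ℤ.*-identityʳ C) ⟨
  y + C * 1ℤ          ≤⟨ ℤ.+-monoʳ-≤ y (ℤ.*-monoˡ-≤-nonNeg C d≥1) ⟩
  y + C * d           ∎
  where
  open ℤ.≤-Reasoning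
  C = + suc ∣ y ∣

potential-step : ∀ {b x d x′ d′} C → 0ℤ <ℤ b → b * x + d ≤ℤ x′ → b * d ≤ℤ d′ →
                 0ℤ <ℤ b * x + + suc C * d → 0ℤ <ℤ b * x′ + + C * d′
potential-step {b} {x} {d} {x′} {d′} C b>0 x′≥ d′≥ P>0 = begin-strict
  0ℤ                                <⟨ *-pos b>0 P>0 ⟩
  b * (b * x + + suc C * d)         ≡⟨ expand b x d (+ C) ⟩
  b * (b * x + d) + + C * (b * d)   ≤⟨ ℤ.+-mono-≤ (ℤ.*-monoˡ-≤-nonNeg b {{nonNegative (ℤ.<⇒≤ b>0)}} x′≥)
                                                  (ℤ.*-monoˡ-≤-nonNeg (+ C) d′≥) ⟩
  b * x′ + + C * d′                 ∎
  where
  open ℤ.≤-Reasoning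
  expand : ∀ b x d c → b * (b * x + (1ℤ + c) * d) ≡ b * (b * x + d) + c * (b * d)
  expand = solve 4 (λ b x d c → b :* (b :* x :+ (con 1ℤ :+ c) :* d)
                              := b :* (b :* x :+ d) :+ c :* (b :* d)) refl

module Iteration {ψ : Series} (ψ≥0 : ∀ i → 0ℤ ≤ℤ ψ i) (ψ₀>0 : 0ℤ <ℤ ψ 0) (ψ₁≥1 : 1ℤ ≤ℤ ψ 1)
  {k : ℕ} (a : ℕ → Series) (a-suc : ∀ n → a (suc n) ≗ ψ ·ₛ a n)
  (a-vanishes : ∀ n → VanishesBelow k (a n)) where

  InMSet-step : ∀ n m → InMSet k (a n) m → InMSet k (a (suc n)) m
  InMSet-step n m a>0 j k≤j j≤m =
    subst (0ℤ <ℤ_) (sym (a-suc n j)) (InMSet-·ₛ ψ≥0 ψ₀>0 (a-vanishes n) a>0 j k≤j j≤m)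

  module Extend (M : ℕ) where

    x d : ℕ → ℤ
    x n = a n (suc M)
    d n = a n M

    x-suc : ∀ {n} → InMSet k (a n) M → ψ 0 * x n + d n ≤ℤ x (suc n)
    x-suc {n} a>0 = begin
      ψ 0 * x n + d n        ≤⟨ ℤ.+-monoʳ-≤ (ψ 0 * x n) d≤ψ₁d ⟩
      ψ 0 * x n + ψ 1 * d n  ≤⟨ head≤·ₛ ψ≥0 a≥0 ⟩
      (ψ ·ₛ a n) (suc M)     ≡⟨ a-suc n (suc M) ⟨
      x (suc n)              ∎
      where
      open ℤ.≤-Reasoning
      a≥0 : ∀ l → l ≤ M → 0ℤ ≤ℤ a n l
      a≥0 = InMSet-nonNeg (a-vanishes n) a>0
      d≤ψ₁d : d n ≤ℤ ψ 1 * d n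
      d≤ψ₁d = begin
        d n        ≡⟨ ℤ.*-identityˡ (d n) ⟨
        1ℤ * d n   ≤⟨ ℤ.*-monoʳ-≤-nonNeg (d n) {{nonNegative (a≥0 M ℕ.≤-refl)}} ψ₁≥1 ⟩
        ψ 1 * d n  ∎

    d-suc : ∀ {n} → InMSet k (a n) M → ψ 0 * d n ≤ℤ d (suc n)
    d-suc {n} a>0 = ℤ.≤-trans (term≤·ₛ ψ≥0 (InMSet-nonNeg (a-vanishes n) a>0) z≤n)
                              (ℤ.≤-reflexive (sym (a-suc n M)))

    from-potential : ∀ C n → InMSet k (a n) M → 0ℤ <ℤ ψ 0 * x n + + C * d n →
                     ∃ λ n′ → InMSet k (a n′) (suc M)
    from-potential zero    n a>0 P>0 = n , InMSet-suc a>0 x>0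
      where
      open ℤ.≤-Reasoning
      x>0 : 0ℤ <ℤ x n
      -- P>0 is used at its normal form: + 0 * d n reduces to 0ℤ.
      x>0 = ℤ.*-cancelˡ-<-nonNeg (ψ 0) {{nonNegative (ψ≥0 0)}} (begin-strict
        ψ 0 * 0ℤ         ≡⟨ ℤ.*-zeroʳ (ψ 0) ⟩
        0ℤ               <⟨ P>0 ⟩
        ψ 0 * x n + 0ℤ   ≡⟨ ℤ.+-identityʳ (ψ 0 * x n) ⟩
        ψ 0 * x n        ∎)
    from-potential (suc C) n a>0 P>0 = from-potential C (suc n) (InMSet-step n M a>0)
      (potential-step C ψ₀>0 (x-suc a>0) (d-suc a>0) P>0)

    extend : ∀ {n} → k ≤ M → InMSet k (a n) M → ∃ λ n′ → InMSet k (a n′) (suc M)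
    extend {n} k≤M a>0 = from-potential (suc ∣ ψ 0 * x n ∣) n a>0
      (potential-start (ψ 0 * x n) (ℤ.i<j⇒suc[i]≤j (a>0 M k≤M ℕ.≤-refl)))

  InMSet-eventually : 0ℤ <ℤ a 0 k → ∀ B → ∃ λ n → InMSet k (a n) B
  InMSet-eventually a₀ₖ>0 zero    = 0 , InMSet-≤k a₀ₖ>0 z≤n
  InMSet-eventually a₀ₖ>0 (suc B) with k ℕ.≤? B
  ... | yes k≤B = Extend.extend B k≤B (proj₂ (InMSet-eventually a₀ₖ>0 B))
  ... | no  k≰B = 0 , InMSet-≤k a₀ₖ>0 (ℕ.≰⇒> k≰B)

lemma7p3 : (k : ℕ) (φ₀ ψ : Series)
    → (∀ j → j < k → φ₀ j ≡ 0ℤ)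
    → φ₀ k ≥ 1ℤ
    → ψ 0 ≥ 1ℤ
    → ψ 1 ≥ 1ℤ
    → (∀ j → 2 ≤ j → ψ j ≥ 0ℤ)
    → (∀ n m → InMSet k (φSeq φ₀ ψ n) m → InMSet k (φSeq φ₀ ψ (suc n)) m)
      × (∀ B → ∃ λ n → InMSet k (φSeq φ₀ ψ n) B)
lemma7p3 k φ₀ ψ φ₀≡0 φ₀ₖ≥1 ψ₀≥1 ψ₁≥1 ψ≥0-from-2 = InMSet-step , InMSet-eventually φ₀ₖ>0
  where
  ψ≥0 : ∀ i → 0ℤ ≤ℤ ψ i
  ψ≥0 0             = ℤ.≤-trans (+≤+ z≤n) ψ₀≥1
  ψ≥0 1             = ℤ.≤-trans (+≤+ z≤n) ψ₁≥1
  ψ≥0 (suc (suc i)) = ψ≥0-from-2 (suc (suc i)) (s≤s (s≤s z≤n))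

  open Iteration ψ≥0 (ℤ.suc[i]≤j⇒i<j ψ₀≥1) ψ₁≥1 (φSeq φ₀ ψ)
    (λ n → f·gh≗g·fh φ₀ ψ (ψ ^ₛ n)) (λ n → ·ₛ-vanishesBelowˡ (ψ ^ₛ n) φ₀≡0)

  φ₀ₖ>0 : 0ℤ <ℤ φSeq φ₀ ψ 0 k
  φ₀ₖ>0 = subst (0ℤ <ℤ_) (sym (·ₛ-identityʳ φ₀ k)) (ℤ.suc[i]≤j⇒i<j φ₀ₖ≥1)
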